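{- Let $P$ and $Q$ be lattice paths from $(0,0)$ to $(m,r)$ with steps $E=(1,0)$, $N=(0,1)$, with $P$ never going above $Q$. For $1\le i\le m+r$ let $p_i$ and $q_i$ be the numbers of North steps among the first $i$ steps of $P$ and of $Q$, respectively. Then $$\mathcal{P}(\mathcal{M}[P,Q])=\Big\{x\in\mathbb{R}^{m+r} : p_i\le x_1+\dots+x_i\le q_i \ (1\le i\le m+r),\ x_1+\dots+x_{m+r}=r,\ 0\le x_i\le 1\ (1\le i\le m+r)\Big\}.$$
   Context: $\mathcal{M}[P,Q]$ is the matroid on $[m+r]$ whose bases are the $r$-subsets $B$ such that the lattice path with North steps exactly at the positions in $B$ (East steps elsewhere) stays in the region bounded by $P$ and $Q$ (equivalently, the transversal matroid with presentation $N_i=[l_i,u_i]$, where $l_i$, $u_i$ are the positions of the $i$-th North step of $Q$ and $P$). The matroid polytope is $\mathcal{P}(\mathcal{M})=\mathrm{conv}\{\sum_{i\in B}e_i : B\text{ a basis}\}$.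
   Formalization: The points x lie in ℚ^(m+r) rather than $\mathbb{R}^{m+r}$, and the convex combinations of basis indicator vectors forming $\mathcal{P}(\mathcal{M}[P,Q])$ have rational coefficients. -}

module Defs where

open import Data.Bool using (Bool; true; false; if_then_else_)
open import Data.Nat as ℕ using (ℕ; zero; suc)
open import Data.Integer using (+_)
open import Data.Rational as ℚ using (ℚ; 0ℚ; 1ℚ; _/_)
open import Data.Vec using (Vec; []; _∷_; map; zipWith; replicate)
open import Data.Fin.Subset using (Subset; ∣_∣)
open import Data.List using (List)
import Data.List as L
open import Data.List.Relation.Unary.All using (All)
open import Data.Product using (_×_; _,_; ∃; proj₁; proj₂)
open import Relation.Binary.PropositionalEquality using (_≡_)

toℚ : ℕ → ℚ
toℚ n = (+ n) / 1

-- A lattice path with m+r steps is encoded as a Vec Bool (m+r):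
-- true = North step, false = East step.  A subset of [m+r] is the same
-- data (Data.Fin.Subset), position j is in the subset iff step j is North.

northPrefix : ∀ {n} → Vec Bool n → ℕ → ℕ
northPrefix _        zero    = 0
northPrefix []       (suc i) = 0
northPrefix (b ∷ v)  (suc i) = (if b then 1 else 0) ℕ.+ northPrefix v i

IsLatticePath : (m r : ℕ) → Vec Bool (m ℕ.+ r) → Set
IsLatticePath m r P = ∣ P ∣ ≡ r

NeverAbove : ∀ {n} → Vec Bool n → Vec Bool n → Set
NeverAbove {n} P Q = ∀ i → 1 ℕ.≤ i → i ℕ.≤ n → northPrefix P i ℕ.≤ northPrefix Q i

IsBasis : (m r : ℕ) → (P Q B : Subset (m ℕ.+ r)) → Set
IsBasis m r P Q B =
  (∣ B ∣ ≡ r) ×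
  (∀ i → 1 ℕ.≤ i → i ℕ.≤ m ℕ.+ r →
     (northPrefix P i ℕ.≤ northPrefix B i) × (northPrefix B i ℕ.≤ northPrefix Q i))

indicator : ∀ {n} → Subset n → Vec ℚ n
indicator = map (λ b → if b then 1ℚ else 0ℚ)

combination : ∀ {n} → List (Subset n × ℚ) → Vec ℚ n
combination {n} = L.foldr (λ p acc → zipWith ℚ._+_ (map (proj₂ p ℚ.*_) (indicator (proj₁ p))) acc)
                          (replicate n 0ℚ)

InConvexHull : ∀ {n} → (Subset n → Set) → Vec ℚ n → Set
InConvexHull {n} S x =
  ∃ λ (cs : List (Subset n × ℚ)) →
    All (λ p → S (proj₁ p) × (0ℚ ℚ.≤ proj₂ p)) cs ×
    (L.foldr ℚ._+_ 0ℚ (L.map proj₂ cs) ≡ 1ℚ) ×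
    (x ≡ combination cs)

InMatroidPolytope : (m r : ℕ) → (P Q : Subset (m ℕ.+ r)) → Vec ℚ (m ℕ.+ r) → Set
InMatroidPolytope m r P Q = InConvexHull (IsBasis m r P Q)

prefixSum : ∀ {n} → Vec ℚ n → ℕ → ℚ
prefixSum _        zero    = 0ℚ
prefixSum []       (suc i) = 0ℚ
prefixSum (x ∷ v)  (suc i) = x ℚ.+ prefixSum v i

InHDescription : (m r : ℕ) → (P Q : Vec Bool (m ℕ.+ r)) → Vec ℚ (m ℕ.+ r) → Set
InHDescription m r P Q x =
  (∀ i → 1 ℕ.≤ i → i ℕ.≤ m ℕ.+ r →
     (toℚ (northPrefix P i) ℚ.≤ prefixSum x i) × (prefixSum x i ℚ.≤ toℚ (northPrefix Q i))) ×
  (prefixSum x (m ℕ.+ r) ≡ toℚ r) ×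
  All' x
  where
    All' : ∀ {k} → Vec ℚ k → Set
    All' v = Data.Vec.Relation.Unary.All.All (λ y → (0ℚ ℚ.≤ y) × (y ℚ.≤ 1ℚ)) v
      where import Data.Vec.Relation.Unary.All

module Submission where

-- (⊆) Every functional that is linear on ℚ^n (prefix sums, coordinates)
--     commutes with convex combinations, so a bound valid at every indicator
--     vector e_B of a basis stays valid on the convex hull.
--
-- (⊇) Clear denominators: x = X / D with X ∈ ℕ^n, D > 0, 0 ≤ X_j ≤ D, and
--     partial sums S_i = X_1 + … + X_i.  For each shift k < D the
--     "staircase" path B_k has ⌊(k + S_i)/D⌋ North steps among its first i
--     steps; the inequalities on x make every B_k a basis, and Hermite's
--     identity  Σ_{k<D} ⌊(k + c)/D⌋ = c  shows that the uniform average of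
--     the e_{B_k} has the same prefix sums as x, hence equals x.

open import Defs
open import Data.Nat using (ℕ; zero; suc; _/_; z≤n)
import Data.Nat as ℕ
import Data.Nat.Properties as ℕP
import Data.Nat.DivMod as ℕD
open import Data.Nat.Divisibility using (∣-refl)
open import Data.Nat.ListAction using (sum)
open import Data.Nat.ListAction.Properties using (sum-++)
open import Data.Integer using (+_; -[1+_])
import Data.Integer as ℤ
import Data.Integer.Properties as ℤP
open import Data.Rational using (ℚ; mkℚ; 0ℚ; 1ℚ; ↥_; ↧ₙ_)
import Data.Rational as ℚ
import Data.Rational.Properties as ℚP
import Data.Rational.Unnormalised as ℚᵘ
open import Data.Rational.Solver using (module +-*-Solver)
open import Algebra.Properties.Group ℚP.+-0-group using (∙-cancelˡ)
import Data.Nat.Coprimality as Coprime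
open import Data.Bool using (Bool; true; false; if_then_else_)
open import Data.Fin using (Fin)
open import Data.Fin.Subset using (Subset; ∣_∣)
open import Data.Vec using (Vec; []; _∷_; map; zipWith; replicate; lookup)
import Data.Vec.Properties as VecP
import Data.Vec.Relation.Unary.All as VAll
import Data.Vec.Relation.Unary.All.Properties as VAllP
open import Data.List using (List; []; _∷_; applyUpTo; upTo; _∷ʳ_)
import Data.List.Properties as ListP
open import Data.List.Relation.Unary.All using (All; []; _∷_)
import Data.List.Relation.Unary.All.Properties as AllP
open import Data.Product using (_×_; _,_; proj₁; proj₂; ∃₂)
open import Function using (_∘_)
open import Function.Bundles using (_⇔_; mk⇔)
open import Relation.Nullary.Reflects using (ofʸ; ofⁿ)
open import Relation.Binary.PropositionalEquality
open ≡-Reasoning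

toℚ-mkℚ : ∀ n → toℚ n ≡ mkℚ (+ n) 0 (Coprime.sym (Coprime.1-coprimeTo n))
toℚ-mkℚ n = ℚP.normalize-coprime (Coprime.sym (Coprime.1-coprimeTo n))

toℚ-+ : ∀ a b → toℚ (a ℕ.+ b) ≡ toℚ a ℚ.+ toℚ b
toℚ-+ a b rewrite toℚ-mkℚ a | toℚ-mkℚ b =
  cong (ℚ._/ 1) (trans (ℤP.pos-+ a b)
    (sym (cong₂ ℤ._+_ (ℤP.*-identityʳ (+ a)) (ℤP.*-identityʳ (+ b)))))

toℚ-* : ∀ a b → toℚ (a ℕ.* b) ≡ toℚ a ℚ.* toℚ b
toℚ-* a b rewrite toℚ-mkℚ a | toℚ-mkℚ b = cong (ℚ._/ 1) (ℤP.pos-* a b)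

toℚ-mono : ∀ {a b} → a ℕ.≤ b → toℚ a ℚ.≤ toℚ b
toℚ-mono {a} {b} a≤b rewrite toℚ-mkℚ a | toℚ-mkℚ b =
  ℚ.*≤* (subst₂ ℤ._≤_ (sym (ℤP.*-identityʳ (+ a))) (sym (ℤP.*-identityʳ (+ b))) (ℤ.+≤+ a≤b))

toℚ-cancel-≤ : ∀ {a b} → toℚ a ℚ.≤ toℚ b → a ℕ.≤ b
toℚ-cancel-≤ {a} {b} le rewrite toℚ-mkℚ a | toℚ-mkℚ b with le
... | ℚ.*≤* h = ℤP.drop‿+≤+ (subst₂ ℤ._≤_ (ℤP.*-identityʳ (+ a)) (ℤP.*-identityʳ (+ b)) h)

toℚ-injective : ∀ {a b} → toℚ a ≡ toℚ b → a ≡ b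
toℚ-injective eq =
  ℕP.≤-antisym (toℚ-cancel-≤ (ℚP.≤-reflexive eq)) (toℚ-cancel-≤ (ℚP.≤-reflexive (sym eq)))

toℚ-nonNeg : ∀ n → 0ℚ ℚ.≤ toℚ n
toℚ-nonNeg n = toℚ-mono {0} {n} z≤n

toℚ-positive : ∀ n .{{_ : ℕ.NonZero n}} → ℚ.Positive (toℚ n)
toℚ-positive (suc n) rewrite toℚ-mkℚ (suc n) = _

toℚ-scale : ∀ a D → toℚ (a ℕ.* D) ≡ toℚ D ℚ.* toℚ a
toℚ-scale a D = trans (toℚ-* a D) (ℚP.*-comm (toℚ a) (toℚ D))

toℚ-numerator : ∀ x → 0ℚ ℚ.≤ x → toℚ ℤ.∣ ↥ x ∣ ≡ toℚ (↧ₙ x) ℚ.* x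
toℚ-numerator (mkℚ (+ a) d _) _ rewrite toℚ-mkℚ (suc d) =
  ℚP.fromℚᵘ-cong {ℚᵘ.mkℚᵘ (+ a) 0} {ℚᵘ.mkℚᵘ (+ suc d ℤ.* + a) (d ℕ.+ 0)} (ℚᵘ.*≡* (begin
    + a ℤ.* + suc (d ℕ.+ 0)          ≡⟨ cong (λ k → + a ℤ.* + suc k) (ℕP.+-identityʳ d) ⟩
    + a ℤ.* + suc d                  ≡⟨ ℤP.*-comm (+ a) (+ suc d) ⟩
    + suc d ℤ.* + a                  ≡⟨ sym (ℤP.*-identityʳ _) ⟩
    (+ suc d ℤ.* + a) ℤ.* + 1        ∎))
toℚ-numerator (mkℚ -[1+ _ ] _ _) (ℚ.*≤* ())

record Linear {n : ℕ} (f : Vec ℚ n → ℚ) : Set where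
  field
    additive    : ∀ u v → f (zipWith ℚ._+_ u v) ≡ f u ℚ.+ f v
    homogeneous : ∀ c u → f (map (c ℚ.*_) u) ≡ c ℚ.* f u
    vanishes    : f (replicate n 0ℚ) ≡ 0ℚ

weightedSum : ∀ {n} → (Subset n → ℚ) → List (Subset n × ℚ) → ℚ
weightedSum g = Data.List.foldr (λ p acc → proj₂ p ℚ.* g (proj₁ p) ℚ.+ acc) 0ℚ

totalWeight : ∀ {n} → List (Subset n × ℚ) → ℚ
totalWeight cs = Data.List.foldr ℚ._+_ 0ℚ (Data.List.map proj₂ cs)

linear-combination : ∀ {n} {f : Vec ℚ n → ℚ} → Linear f →
  ∀ cs → f (combination cs) ≡ weightedSum (f ∘ indicator) cs
linear-combination lin [] = Linear.vanishes lin
linear-combination {f = f} lin ((B , c) ∷ cs) = begin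
  f (zipWith ℚ._+_ (map (c ℚ.*_) (indicator B)) (combination cs))
    ≡⟨ Linear.additive lin _ _ ⟩
  f (map (c ℚ.*_) (indicator B)) ℚ.+ f (combination cs)
    ≡⟨ cong₂ ℚ._+_ (Linear.homogeneous lin c (indicator B)) (linear-combination lin cs) ⟩
  c ℚ.* f (indicator B) ℚ.+ weightedSum (f ∘ indicator) cs ∎

weightedSum-mono : ∀ {n} {S : Subset n → Set} {g h : Subset n → ℚ} →
  (∀ {B} → S B → g B ℚ.≤ h B) →
  ∀ {cs} → All (λ p → S (proj₁ p) × (0ℚ ℚ.≤ proj₂ p)) cs →
  weightedSum g cs ℚ.≤ weightedSum h cs
weightedSum-mono g≤h [] = ℚP.≤-refl
weightedSum-mono g≤h {(_ , c) ∷ _} ((sB , c≥0) ∷ rest) =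
  ℚP.+-mono-≤ (ℚP.*-monoˡ-≤-nonNeg c {{ℚ.nonNegative c≥0}} (g≤h sB)) (weightedSum-mono g≤h rest)

weightedSum-const : ∀ {n} (c : ℚ) (cs : List (Subset n × ℚ)) →
  weightedSum (λ _ → c) cs ≡ c ℚ.* totalWeight cs
weightedSum-const c [] = sym (ℚP.*-zeroʳ c)
weightedSum-const c ((_ , λ₀) ∷ cs) = begin
  λ₀ ℚ.* c ℚ.+ weightedSum (λ _ → c) cs ≡⟨ cong (λ₀ ℚ.* c ℚ.+_) (weightedSum-const c cs) ⟩
  λ₀ ℚ.* c ℚ.+ c ℚ.* totalWeight cs     ≡⟨ distribute λ₀ c (totalWeight cs) ⟩
  c ℚ.* (λ₀ ℚ.+ totalWeight cs)         ∎
  where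
  open +-*-Solver
  distribute : ∀ a c t → a ℚ.* c ℚ.+ c ℚ.* t ≡ c ℚ.* (a ℚ.+ t)
  distribute = solve 3 (λ a c t → a :* c :+ c :* t := c :* (a :+ t)) refl

hull-bounds : ∀ {n} {S : Subset n → Set} {f : Vec ℚ n → ℚ} → Linear f →
  (lo hi : ℚ) → (∀ {B} → S B → (lo ℚ.≤ f (indicator B)) × (f (indicator B) ℚ.≤ hi)) →
  ∀ {x} → InConvexHull S x → (lo ℚ.≤ f x) × (f x ℚ.≤ hi)
hull-bounds {f = f} lin lo hi bounded (cs , support , weights≡1 , refl) =
  subst₂ ℚ._≤_ (average lo) value (weightedSum-mono (λ s → proj₁ (bounded s)) support) ,
  subst₂ ℚ._≤_ value (average hi) (weightedSum-mono (λ s → proj₂ (bounded s)) support)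
  where
  average : ∀ c → weightedSum (λ _ → c) cs ≡ c
  average c = trans (weightedSum-const c cs) (trans (cong (c ℚ.*_) weights≡1) (ℚP.*-identityʳ c))
  value : weightedSum (f ∘ indicator) cs ≡ f (combination cs)
  value = sym (linear-combination lin cs)

prefixSum-linear : ∀ {n} i → Linear {n} (λ v → prefixSum v i)
prefixSum-linear {n} i = record
  { additive = additive i ; homogeneous = homogeneous i ; vanishes = vanishes n i }
  where
  open +-*-Solver
  interchange : ∀ a b c d → (a ℚ.+ b) ℚ.+ (c ℚ.+ d) ≡ (a ℚ.+ c) ℚ.+ (b ℚ.+ d)
  interchange = solve 4 (λ a b c d → (a :+ b) :+ (c :+ d) := (a :+ c) :+ (b :+ d)) refl

  additive : ∀ {k} i (u v : Vec ℚ k) →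
    prefixSum (zipWith ℚ._+_ u v) i ≡ prefixSum u i ℚ.+ prefixSum v i
  additive zero    _       _       = refl
  additive (suc i) []      []      = refl
  additive (suc i) (a ∷ u) (b ∷ v) =
    trans (cong (a ℚ.+ b ℚ.+_) (additive i u v)) (interchange a b _ _)

  homogeneous : ∀ {k} i c (u : Vec ℚ k) → prefixSum (map (c ℚ.*_) u) i ≡ c ℚ.* prefixSum u i
  homogeneous zero    c _       = sym (ℚP.*-zeroʳ c)
  homogeneous (suc i) c []      = sym (ℚP.*-zeroʳ c)
  homogeneous (suc i) c (a ∷ u) =
    trans (cong (c ℚ.* a ℚ.+_) (homogeneous i c u)) (sym (ℚP.*-distribˡ-+ c a _))

  vanishes : ∀ k i → prefixSum (replicate k 0ℚ) i ≡ 0ℚ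
  vanishes _       zero    = refl
  vanishes zero    (suc i) = refl
  vanishes (suc k) (suc i) = trans (ℚP.+-identityˡ _) (vanishes k i)

lookup-linear : ∀ {n} (j : Fin n) → Linear (λ v → lookup v j)
lookup-linear j = record
  { additive    = VecP.lookup-zipWith ℚ._+_ j
  ; homogeneous = λ c u → VecP.lookup-map j (c ℚ.*_) u
  ; vanishes    = VecP.lookup-replicate j 0ℚ
  }

prefixSum-indicator : ∀ {n} (B : Subset n) i → prefixSum (indicator B) i ≡ toℚ (northPrefix B i)
prefixSum-indicator B           zero    = refl
prefixSum-indicator []          (suc i) = refl
prefixSum-indicator (true ∷ B)  (suc i) =
  trans (cong (1ℚ ℚ.+_) (prefixSum-indicator B i)) (sym (toℚ-+ 1 (northPrefix B i)))
prefixSum-indicator (false ∷ B) (suc i) = trans (ℚP.+-identityˡ _) (prefixSum-indicator B i)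

indicator-entry : ∀ {n} (B : Subset n) j →
  (0ℚ ℚ.≤ lookup (indicator B) j) × (lookup (indicator B) j ℚ.≤ 1ℚ)
indicator-entry B j rewrite VecP.lookup-map j (λ b → if b then 1ℚ else 0ℚ) B with lookup B j
... | true  = toℚ-nonNeg 1 , ℚP.≤-refl
... | false = ℚP.≤-refl , toℚ-nonNeg 1

northPrefix-full : ∀ {n} (B : Subset n) → northPrefix B n ≡ ∣ B ∣
northPrefix-full []          = refl
northPrefix-full (true ∷ B)  = cong suc (northPrefix-full B)
northPrefix-full (false ∷ B) = northPrefix-full B

prefixSum-injective : ∀ {n} (u v : Vec ℚ n) → (∀ i → prefixSum u i ≡ prefixSum v i) → u ≡ v
prefixSum-injective []      []      _   = refl
prefixSum-injective (a ∷ u) (b ∷ v) eqs = cong₂ _∷_ a≡b (prefixSum-injective u v tail-eq)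
  where
  a≡b : a ≡ b
  a≡b = trans (sym (ℚP.+-identityʳ a)) (trans (eqs 1) (ℚP.+-identityʳ b))
  tail-eq : ∀ i → prefixSum u i ≡ prefixSum v i
  tail-eq i = ∙-cancelˡ a _ _ (trans (eqs (suc i)) (cong (ℚ._+ prefixSum v i) (sym a≡b)))

-- Soundness: each defining inequality holds at every e_B of a basis, hence
-- on the convex hull.
polytope⊆H : (m r : ℕ) (P Q : Vec Bool (m ℕ.+ r)) (x : Vec ℚ (m ℕ.+ r)) →
  InMatroidPolytope m r P Q x → InHDescription m r P Q x
polytope⊆H m r P Q x hull = prefix-bounds , total , coordinates
  where
  n : ℕ
  n = m ℕ.+ r
  prefix-bounds : ∀ i → 1 ℕ.≤ i → i ℕ.≤ n →
    (toℚ (northPrefix P i) ℚ.≤ prefixSum x i) × (prefixSum x i ℚ.≤ toℚ (northPrefix Q i))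
  prefix-bounds i 1≤i i≤n = hull-bounds (prefixSum-linear i) _ _ basis-bounds hull
    where
    basis-bounds : ∀ {B} → IsBasis m r P Q B →
      (toℚ (northPrefix P i) ℚ.≤ prefixSum (indicator B) i) ×
      (prefixSum (indicator B) i ℚ.≤ toℚ (northPrefix Q i))
    basis-bounds {B} (_ , between) rewrite prefixSum-indicator B i =
      toℚ-mono (proj₁ (between i 1≤i i≤n)) , toℚ-mono (proj₂ (between i 1≤i i≤n))

  total : prefixSum x n ≡ toℚ r
  total = ℚP.≤-antisym (proj₂ r≤x≤r) (proj₁ r≤x≤r)
    where
    basis-size : ∀ {B} → IsBasis m r P Q B →
      (toℚ r ℚ.≤ prefixSum (indicator B) n) × (prefixSum (indicator B) n ℚ.≤ toℚ r)
    basis-size {B} (size , _) rewrite prefixSum-indicator B n | northPrefix-full B | size =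
      ℚP.≤-refl , ℚP.≤-refl
    r≤x≤r : (toℚ r ℚ.≤ prefixSum x n) × (prefixSum x n ℚ.≤ toℚ r)
    r≤x≤r = hull-bounds (prefixSum-linear n) _ _ basis-size hull

  coordinates : VAll.All (λ y → (0ℚ ℚ.≤ y) × (y ℚ.≤ 1ℚ)) x
  coordinates = subst (VAll.All _) (VecP.tabulate∘lookup x)
    (VAllP.tabulate⁺ (λ j → hull-bounds (lookup-linear j) _ _ (λ {B} _ → indicator-entry B j) hull))

natPrefixSum : ∀ {n} → Vec ℕ n → ℕ → ℕ
natPrefixSum _        zero    = 0
natPrefixSum []       (suc i) = 0
natPrefixSum (X ∷ Xs) (suc i) = X ℕ.+ natPrefixSum Xs i

data ScaledBy (D : ℕ) : ∀ {n} → Vec ℕ n → Vec ℚ n → Set where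
  []  : ScaledBy D [] []
  _∷_ : ∀ {n X y} {Xs : Vec ℕ n} {xs} →
        toℚ X ≡ toℚ D ℚ.* y → ScaledBy D Xs xs → ScaledBy D (X ∷ Xs) (y ∷ xs)

scaled-rescale : ∀ {D n} k {Xs : Vec ℕ n} {xs} →
  ScaledBy D Xs xs → ScaledBy (k ℕ.* D) (map (k ℕ.*_) Xs) xs
scaled-rescale k [] = []
scaled-rescale {D} k {X ∷ _} {y ∷ _} (X≡Dy ∷ rest) = rescaled ∷ scaled-rescale k rest
  where
  rescaled : toℚ (k ℕ.* X) ≡ toℚ (k ℕ.* D) ℚ.* y
  rescaled = begin
    toℚ (k ℕ.* X)             ≡⟨ toℚ-* k X ⟩
    toℚ k ℚ.* toℚ X           ≡⟨ cong (toℚ k ℚ.*_) X≡Dy ⟩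
    toℚ k ℚ.* (toℚ D ℚ.* y)   ≡⟨ sym (ℚP.*-assoc (toℚ k) (toℚ D) y) ⟩
    toℚ k ℚ.* toℚ D ℚ.* y     ≡⟨ cong (ℚ._* y) (sym (toℚ-* k D)) ⟩
    toℚ (k ℕ.* D) ℚ.* y       ∎

clearDenominators : ∀ {n} (xs : Vec ℚ n) → VAll.All (0ℚ ℚ.≤_) xs →
  ∃₂ λ d (Xs : Vec ℕ n) → ScaledBy (suc d) Xs xs
clearDenominators [] VAll.[] = 0 , [] , []
clearDenominators (x ∷ xs) (x≥0 VAll.∷ xs≥0) with clearDenominators xs xs≥0
... | d , Xs , scaled =
  -- new denominator ↧x · (1 + d), written as the successor of this witness
  d ℕ.+ ℚ.ℚ.denominator-1 x ℕ.* suc d ,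
  ℤ.∣ ↥ x ∣ ℕ.* suc d ∷ map (↧ₙ x ℕ.*_) Xs ,
  numerator ∷ scaled-rescale (↧ₙ x) scaled
  where
  open +-*-Solver
  regroup : ∀ a b y → a ℚ.* y ℚ.* b ≡ a ℚ.* b ℚ.* y
  regroup = solve 3 (λ a b y → a :* y :* b := a :* b :* y) refl
  numerator : toℚ (ℤ.∣ ↥ x ∣ ℕ.* suc d) ≡ toℚ (↧ₙ x ℕ.* suc d) ℚ.* x
  numerator = begin
    toℚ (ℤ.∣ ↥ x ∣ ℕ.* suc d)                ≡⟨ toℚ-* ℤ.∣ ↥ x ∣ (suc d) ⟩
    toℚ ℤ.∣ ↥ x ∣ ℚ.* toℚ (suc d)            ≡⟨ cong (ℚ._* toℚ (suc d)) (toℚ-numerator x x≥0) ⟩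
    toℚ (↧ₙ x) ℚ.* x ℚ.* toℚ (suc d)         ≡⟨ regroup (toℚ (↧ₙ x)) (toℚ (suc d)) x ⟩
    toℚ (↧ₙ x) ℚ.* toℚ (suc d) ℚ.* x         ≡⟨ cong (ℚ._* x) (sym (toℚ-* (↧ₙ x) (suc d))) ⟩
    toℚ (↧ₙ x ℕ.* suc d) ℚ.* x               ∎

scaled-prefixSum : ∀ {D n} {Xs : Vec ℕ n} {xs} → ScaledBy D Xs xs →
  ∀ i → toℚ (natPrefixSum Xs i) ≡ toℚ D ℚ.* prefixSum xs i
scaled-prefixSum {D} _  zero    = sym (ℚP.*-zeroʳ (toℚ D))
scaled-prefixSum {D} [] (suc i) = sym (ℚP.*-zeroʳ (toℚ D))
scaled-prefixSum {D} {Xs = X ∷ Xs} {y ∷ xs} (X≡Dy ∷ rest) (suc i) = begin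
  toℚ (X ℕ.+ natPrefixSum Xs i)                     ≡⟨ toℚ-+ X _ ⟩
  toℚ X ℚ.+ toℚ (natPrefixSum Xs i)                 ≡⟨ cong₂ ℚ._+_ X≡Dy (scaled-prefixSum rest i) ⟩
  toℚ D ℚ.* y ℚ.+ toℚ D ℚ.* prefixSum xs i          ≡⟨ sym (ℚP.*-distribˡ-+ (toℚ D) y _) ⟩
  toℚ D ℚ.* (y ℚ.+ prefixSum xs i)                  ∎

scaled-≤ : ∀ {D n} {Xs : Vec ℕ n} {xs} → ScaledBy D Xs xs →
  VAll.All (ℚ._≤ 1ℚ) xs → VAll.All (ℕ._≤ D) Xs
scaled-≤ [] VAll.[] = VAll.[]
scaled-≤ {D} (X≡Dy ∷ rest) (y≤1 VAll.∷ xs≤1) =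
  toℚ-cancel-≤ (subst₂ ℚ._≤_ (sym X≡Dy) (ℚP.*-identityʳ (toℚ D))
    (ℚP.*-monoˡ-≤-nonNeg (toℚ D) {{ℚ.nonNegative (toℚ-nonNeg D)}} y≤1))
  VAll.∷ scaled-≤ rest xs≤1

scaled-lower : ∀ a D {Y y} → toℚ Y ≡ toℚ D ℚ.* y → toℚ a ℚ.≤ y → a ℕ.* D ℕ.≤ Y
scaled-lower a D Y≡Dy a≤y = toℚ-cancel-≤ (subst₂ ℚ._≤_ (sym (toℚ-scale a D)) (sym Y≡Dy)
  (ℚP.*-monoˡ-≤-nonNeg (toℚ D) {{ℚ.nonNegative (toℚ-nonNeg D)}} a≤y))

scaled-upper : ∀ a D {Y y} → toℚ Y ≡ toℚ D ℚ.* y → y ℚ.≤ toℚ a → Y ℕ.≤ a ℕ.* D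
scaled-upper a D Y≡Dy y≤a = toℚ-cancel-≤ (subst₂ ℚ._≤_ (sym Y≡Dy) (sym (toℚ-scale a D))
  (ℚP.*-monoˡ-≤-nonNeg (toℚ D) {{ℚ.nonNegative (toℚ-nonNeg D)}} y≤a))

uniform-weightedSum : ∀ {n} (g : Subset n → ℚ) (B : ℕ → Subset n) (h : ℕ → ℕ) (w : ℚ) t →
  (∀ {k} → k ℕ.< t → g (B k) ≡ toℚ (h k)) →
  weightedSum g (applyUpTo (λ k → (B k , w)) t) ≡ w ℚ.* toℚ (sum (applyUpTo h t))
uniform-weightedSum g B h w zero    _   = sym (ℚP.*-zeroʳ w)
uniform-weightedSum g B h w (suc t) g≡h = begin
  w ℚ.* g (B 0) ℚ.+ weightedSum g (applyUpTo (λ k → (B (suc k) , w)) t)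
    ≡⟨ cong₂ ℚ._+_ (cong (w ℚ.*_) (g≡h ℕ.z<s))
                   (uniform-weightedSum g (B ∘ suc) (h ∘ suc) w t (λ k<t → g≡h (ℕ.s<s k<t))) ⟩
  w ℚ.* toℚ (h 0) ℚ.+ w ℚ.* toℚ (sum (applyUpTo (h ∘ suc) t))
    ≡⟨ sym (ℚP.*-distribˡ-+ w _ _) ⟩
  w ℚ.* (toℚ (h 0) ℚ.+ toℚ (sum (applyUpTo (h ∘ suc) t)))
    ≡⟨ cong (w ℚ.*_) (sym (toℚ-+ (h 0) _)) ⟩
  w ℚ.* toℚ (h 0 ℕ.+ sum (applyUpTo (h ∘ suc) t)) ∎

uniform-totalWeight : ∀ {n} (B : ℕ → Subset n) (w : ℚ) t →
  totalWeight (applyUpTo (λ k → (B k , w)) t) ≡ w ℚ.* toℚ t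
uniform-totalWeight B w zero    = sym (ℚP.*-zeroʳ w)
uniform-totalWeight B w (suc t) = begin
  w ℚ.+ totalWeight (applyUpTo (λ k → (B (suc k) , w)) t) ≡⟨ cong (w ℚ.+_) (uniform-totalWeight (B ∘ suc) w t) ⟩
  w ℚ.+ w ℚ.* toℚ t                                     ≡⟨ cong (ℚ._+ w ℚ.* toℚ t) (sym (ℚP.*-identityʳ w)) ⟩
  w ℚ.* 1ℚ ℚ.+ w ℚ.* toℚ t                              ≡⟨ sym (ℚP.*-distribˡ-+ w 1ℚ (toℚ t)) ⟩
  w ℚ.* (1ℚ ℚ.+ toℚ t)                                  ≡⟨ cong (w ℚ.*_) (sym (toℚ-+ 1 t)) ⟩
  w ℚ.* toℚ (suc t)                                     ∎

applyUpTo-cong : ∀ {A : Set} {f g : ℕ → A} → (∀ k → f k ≡ g k) → ∀ t → applyUpTo f t ≡ applyUpTo g t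
applyUpTo-cong {f = f} {g} f≗g t =
  trans (sym (ListP.map-upTo f t)) (trans (ListP.map-cong f≗g (upTo t)) (ListP.map-upTo g t))

module Staircase (D : ℕ) .{{_ : ℕ.NonZero D}} where

  floor-add : ∀ a → (D ℕ.+ a) / D ≡ suc (a / D)
  floor-add a = trans (ℕD.+-distrib-/-∣ˡ a ∣-refl) (cong (ℕ._+ a / D) (ℕD.n/n≡1 D))

  stepBit : ℕ → ℕ → Bool
  stepBit a X = a / D ℕ.<ᵇ (a ℕ.+ X) / D

  stepBit-floor : ∀ a X → X ℕ.≤ D → (if stepBit a X then 1 else 0) ℕ.+ a / D ≡ (a ℕ.+ X) / D
  stepBit-floor a X X≤D with stepBit a X | ℕP.<ᵇ-reflects-< (a / D) ((a ℕ.+ X) / D)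
  ... | true  | ofʸ lt = ℕP.≤-antisym lt (ℕP.≤-trans (ℕD./-monoˡ-≤ D (ℕP.+-monoʳ-≤ a X≤D))
                   (ℕP.≤-reflexive (trans (cong (_/ D) (ℕP.+-comm a D)) (floor-add a))))
  ... | false | ofⁿ ¬lt = ℕP.≤-antisym (ℕD./-monoˡ-≤ D (ℕP.m≤m+n a X)) (ℕP.≮⇒≥ ¬lt)

  staircase : ∀ {n} → ℕ → Vec ℕ n → Subset n
  staircase a []       = []
  staircase a (X ∷ Xs) = stepBit a X ∷ staircase (a ℕ.+ X) Xs

  staircase-floor : ∀ {n} a (Xs : Vec ℕ n) → VAll.All (ℕ._≤ D) Xs → ∀ i →
    northPrefix (staircase a Xs) i ℕ.+ a / D ≡ (a ℕ.+ natPrefixSum Xs i) / D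
  staircase-floor a _        _            zero    = cong (_/ D) (sym (ℕP.+-identityʳ a))
  staircase-floor a []       _            (suc i) = cong (_/ D) (sym (ℕP.+-identityʳ a))
  staircase-floor a (X ∷ Xs) (X≤D VAll.∷ Xs≤D) (suc i) = begin
    b ℕ.+ p ℕ.+ a / D              ≡⟨ cong (ℕ._+ a / D) (ℕP.+-comm b p) ⟩
    p ℕ.+ b ℕ.+ a / D              ≡⟨ ℕP.+-assoc p b (a / D) ⟩
    p ℕ.+ (b ℕ.+ a / D)            ≡⟨ cong (p ℕ.+_) (stepBit-floor a X X≤D) ⟩
    p ℕ.+ (a ℕ.+ X) / D            ≡⟨ staircase-floor (a ℕ.+ X) Xs Xs≤D i ⟩
    (a ℕ.+ X ℕ.+ S) / D            ≡⟨ cong (_/ D) (ℕP.+-assoc a X S) ⟩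
    (a ℕ.+ (X ℕ.+ S)) / D          ∎
    where
    b p S : ℕ
    b = if stepBit a X then 1 else 0
    p = northPrefix (staircase (a ℕ.+ X) Xs) i
    S = natPrefixSum Xs i

  staircase-prefix : ∀ {n} k (Xs : Vec ℕ n) → k ℕ.< D → VAll.All (ℕ._≤ D) Xs → ∀ i →
    northPrefix (staircase k Xs) i ≡ (k ℕ.+ natPrefixSum Xs i) / D
  staircase-prefix k Xs k<D Xs≤D i = begin
    p             ≡⟨ sym (ℕP.+-identityʳ p) ⟩
    p ℕ.+ 0       ≡⟨ cong (p ℕ.+_) (sym (ℕD.m<n⇒m/n≡0 k<D)) ⟩
    p ℕ.+ k / D   ≡⟨ staircase-floor k Xs Xs≤D i ⟩
    (k ℕ.+ natPrefixSum Xs i) / D ∎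
    where
    p : ℕ
    p = northPrefix (staircase k Xs) i

  floor-between : ∀ {k Y lo hi} → k ℕ.< D → lo ℕ.* D ℕ.≤ Y → Y ℕ.≤ hi ℕ.* D →
    (lo ℕ.≤ (k ℕ.+ Y) / D) × ((k ℕ.+ Y) / D ℕ.≤ hi)
  floor-between {k} {Y} {lo} k<D loD≤Y Y≤hiD =
    ℕP.≤-trans (ℕP.≤-reflexive (sym (ℕD.m*n/n≡m lo D))) (ℕD./-monoˡ-≤ D (ℕP.≤-trans loD≤Y (ℕP.m≤n+m Y k))) ,
    ℕP.≤-pred (ℕD.m<n*o⇒m/o<n (ℕP.+-mono-<-≤ k<D Y≤hiD))

  staircase-isBasis : (m r : ℕ) (P Q : Vec Bool (m ℕ.+ r)) (Xs : Vec ℕ (m ℕ.+ r)) →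
    VAll.All (ℕ._≤ D) Xs →
    (∀ i → 1 ℕ.≤ i → i ℕ.≤ m ℕ.+ r →
       (northPrefix P i ℕ.* D ℕ.≤ natPrefixSum Xs i) × (natPrefixSum Xs i ℕ.≤ northPrefix Q i ℕ.* D)) →
    natPrefixSum Xs (m ℕ.+ r) ≡ r ℕ.* D →
    ∀ {k} → k ℕ.< D → IsBasis m r P Q (staircase k Xs)
  staircase-isBasis m r P Q Xs Xs≤D bounds total {k} k<D = size , between
    where
    prefix : ∀ i → northPrefix (staircase k Xs) i ≡ (k ℕ.+ natPrefixSum Xs i) / D
    prefix = staircase-prefix k Xs k<D Xs≤D
    size : ∣ staircase k Xs ∣ ≡ r
    size = begin
      ∣ staircase k Xs ∣                        ≡⟨ sym (northPrefix-full (staircase k Xs)) ⟩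
      northPrefix (staircase k Xs) (m ℕ.+ r)   ≡⟨ prefix (m ℕ.+ r) ⟩
      (k ℕ.+ natPrefixSum Xs (m ℕ.+ r)) / D    ≡⟨ ℕP.≤-antisym (proj₂ r≤⌊⌋≤r) (proj₁ r≤⌊⌋≤r) ⟩
      r                                        ∎
      where
      r≤⌊⌋≤r : (r ℕ.≤ (k ℕ.+ natPrefixSum Xs (m ℕ.+ r)) / D) × ((k ℕ.+ natPrefixSum Xs (m ℕ.+ r)) / D ℕ.≤ r)
      r≤⌊⌋≤r = floor-between k<D (ℕP.≤-reflexive (sym total)) (ℕP.≤-reflexive total)
    between : ∀ i → 1 ℕ.≤ i → i ℕ.≤ m ℕ.+ r →
      (northPrefix P i ℕ.≤ northPrefix (staircase k Xs) i) × (northPrefix (staircase k Xs) i ℕ.≤ northPrefix Q i)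
    between i 1≤i i≤n rewrite prefix i = floor-between k<D (proj₁ (bounds i 1≤i i≤n)) (proj₂ (bounds i 1≤i i≤n))

  floorSum : ℕ → ℕ → ℕ
  floorSum c t = sum (applyUpTo (λ k → (k ℕ.+ c) / D) t)

  floorSum-snoc : ∀ c t → floorSum c (suc t) ≡ floorSum c t ℕ.+ (t ℕ.+ c) / D
  floorSum-snoc c t = begin
    sum (applyUpTo f (suc t))                 ≡⟨ cong sum (sym (ListP.applyUpTo-∷ʳ f t)) ⟩
    sum (applyUpTo f t ∷ʳ f t)                ≡⟨ sum-++ (applyUpTo f t) (f t ∷ []) ⟩
    sum (applyUpTo f t) ℕ.+ (f t ℕ.+ 0)       ≡⟨ cong (sum (applyUpTo f t) ℕ.+_) (ℕP.+-identityʳ (f t)) ⟩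
    sum (applyUpTo f t) ℕ.+ f t               ∎
    where
    f : ℕ → ℕ
    f k = (k ℕ.+ c) / D

  floorSum-cons : ∀ c t → floorSum c (suc t) ≡ c / D ℕ.+ floorSum (suc c) t
  floorSum-cons c t = cong (c / D ℕ.+_) (cong sum
    (applyUpTo-cong (λ k → cong (_/ D) (sym (ℕP.+-suc k c))) t))

  floorSum-zero : ∀ t → t ℕ.≤ D → floorSum 0 t ≡ 0
  floorSum-zero zero    _   = refl
  floorSum-zero (suc t) t<D = trans (floorSum-snoc 0 t)
    (cong₂ ℕ._+_ (floorSum-zero t (ℕP.<⇒≤ t<D))
                 (ℕD.m<n⇒m/n≡0 (subst (ℕ._< D) (sym (ℕP.+-identityʳ t)) t<D)))

  hermite : ∀ c → floorSum c D ≡ c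
  hermite zero    = floorSum-zero D ℕP.≤-refl
  hermite (suc c) = ℕP.+-cancelˡ-≡ (c / D) _ _ (begin
    c / D ℕ.+ floorSum (suc c) D        ≡⟨ sym (floorSum-cons c D) ⟩
    floorSum c (suc D)                  ≡⟨ floorSum-snoc c D ⟩
    floorSum c D ℕ.+ (D ℕ.+ c) / D      ≡⟨ cong₂ ℕ._+_ (hermite c) (floor-add c) ⟩
    c ℕ.+ suc (c / D)                   ≡⟨ ℕP.+-suc c (c / D) ⟩
    suc (c ℕ.+ c / D)                   ≡⟨ cong suc (ℕP.+-comm c (c / D)) ⟩
    suc (c / D ℕ.+ c)                   ≡⟨ sym (ℕP.+-suc (c / D) c) ⟩
    c / D ℕ.+ suc c                     ∎)

  weight : ℚ
  weight = (ℚ.1/ toℚ D) {{ℚP.pos⇒nonZero (toℚ D) {{toℚ-positive D}}}}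

  weight-nonNeg : 0ℚ ℚ.≤ weight
  weight-nonNeg = ℚP.<⇒≤ (ℚP.positive⁻¹ weight {{ℚP.1/pos⇒pos (toℚ D) {{toℚ-positive D}}}})

  weight-inverse : weight ℚ.* toℚ D ≡ 1ℚ
  weight-inverse = ℚP.*-inverseˡ (toℚ D) {{ℚP.pos⇒nonZero (toℚ D) {{toℚ-positive D}}}}

  staircaseAverage : ∀ {n} → Vec ℕ n → List (Subset n × ℚ)
  staircaseAverage Xs = applyUpTo (λ k → (staircase k Xs , weight)) D

  staircaseAverage-weights : ∀ {n} (Xs : Vec ℕ n) → totalWeight (staircaseAverage Xs) ≡ 1ℚ
  staircaseAverage-weights Xs = trans (uniform-totalWeight (λ k → staircase k Xs) weight D) weight-inverse

  -- The staircase average of X is X / D: both have prefix sums S_i / D, by Hermite.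
  staircaseAverage-combination : ∀ {n} {Xs : Vec ℕ n} {xs} → ScaledBy D Xs xs →
    VAll.All (ℕ._≤ D) Xs → combination (staircaseAverage Xs) ≡ xs
  staircaseAverage-combination {n} {Xs} {xs} scaled Xs≤D =
    prefixSum-injective _ _ λ i → begin
      prefixSum (combination cs) i
        ≡⟨ linear-combination (prefixSum-linear i) cs ⟩
      weightedSum (λ B → prefixSum (indicator B) i) cs
        ≡⟨ uniform-weightedSum _ (λ k → staircase k Xs) (λ k → (k ℕ.+ natPrefixSum Xs i) / D) weight D
             (λ {k} k<D → trans (prefixSum-indicator (staircase k Xs) i)
                                (cong toℚ (staircase-prefix k Xs k<D Xs≤D i))) ⟩
      weight ℚ.* toℚ (floorSum (natPrefixSum Xs i) D)
        ≡⟨ cong (λ s → weight ℚ.* toℚ s) (hermite (natPrefixSum Xs i)) ⟩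
      weight ℚ.* toℚ (natPrefixSum Xs i)
        ≡⟨ cong (weight ℚ.*_) (scaled-prefixSum scaled i) ⟩
      weight ℚ.* (toℚ D ℚ.* prefixSum xs i)
        ≡⟨ sym (ℚP.*-assoc weight (toℚ D) _) ⟩
      weight ℚ.* toℚ D ℚ.* prefixSum xs i
        ≡⟨ cong (ℚ._* prefixSum xs i) weight-inverse ⟩
      1ℚ ℚ.* prefixSum xs i
        ≡⟨ ℚP.*-identityˡ _ ⟩
      prefixSum xs i ∎
    where
    cs : List (Subset n × ℚ)
    cs = staircaseAverage Xs

-- Completeness: a point of the H-description is the staircase average of
-- its scaled numerator vector.
H⊆polytope : (m r : ℕ) (P Q : Vec Bool (m ℕ.+ r)) (x : Vec ℚ (m ℕ.+ r)) →
  InHDescription m r P Q x → InMatroidPolytope m r P Q x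
H⊆polytope m r P Q x (prefix-bounds , total , coordinates)
  with clearDenominators x (VAll.map proj₁ coordinates)
... | d , Xs , scaled =
  staircaseAverage Xs , support , staircaseAverage-weights Xs , sym (staircaseAverage-combination scaled Xs≤D)
  where
  open Staircase (suc d)
  n : ℕ
  n = m ℕ.+ r
  Xs≤D : VAll.All (ℕ._≤ suc d) Xs
  Xs≤D = scaled-≤ scaled (VAll.map proj₂ coordinates)
  integer-bounds : ∀ i → 1 ℕ.≤ i → i ℕ.≤ n →
    (northPrefix P i ℕ.* suc d ℕ.≤ natPrefixSum Xs i) × (natPrefixSum Xs i ℕ.≤ northPrefix Q i ℕ.* suc d)
  integer-bounds i 1≤i i≤n =
    scaled-lower (northPrefix P i) (suc d) (scaled-prefixSum scaled i) (proj₁ (prefix-bounds i 1≤i i≤n)) ,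
    scaled-upper (northPrefix Q i) (suc d) (scaled-prefixSum scaled i) (proj₂ (prefix-bounds i 1≤i i≤n))
  integer-total : natPrefixSum Xs n ≡ r ℕ.* suc d
  integer-total = toℚ-injective (begin
    toℚ (natPrefixSum Xs n)       ≡⟨ scaled-prefixSum scaled n ⟩
    toℚ (suc d) ℚ.* prefixSum x n ≡⟨ cong (toℚ (suc d) ℚ.*_) total ⟩
    toℚ (suc d) ℚ.* toℚ r         ≡⟨ sym (toℚ-scale r (suc d)) ⟩
    toℚ (r ℕ.* suc d)             ∎)
  support : All (λ p → IsBasis m r P Q (proj₁ p) × (0ℚ ℚ.≤ proj₂ p)) (staircaseAverage Xs)
  support = AllP.applyUpTo⁺₁ _ (suc d)
    (λ k<D → staircase-isBasis m r P Q Xs Xs≤D integer-bounds integer-total k<D , weight-nonNeg)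

mainTheorem5 : (m r : ℕ) (P Q : Vec Bool (m Data.Nat.+ r)) →
    IsLatticePath m r P → IsLatticePath m r Q → NeverAbove P Q →
    (x : Vec ℚ (m Data.Nat.+ r)) →
    InMatroidPolytope m r P Q x ⇔ InHDescription m r P Q x
mainTheorem5 m r P Q _ _ _ x = mk⇔ (polytope⊆H m r P Q x) (H⊆polytope m r P Q x)
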